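{- (1) For every expression $e$ and type $\tau$: $[]\vdash e\triangleright\tau$ if and only if $[\![e]\!]\Vdash\tau$. (2) For every tuple $t$ and type $\tau$: $[]\vdash t\triangleright\tau$ if and only if $[\![t]\!]\Vdash\tau$. (3) For every predicate $\psi$: $[]\vdash\psi\triangleright\mathit{Bool}$ if and only if $[\![\psi]\!]\neq\mathit{err}$.
   Context: Syntax. Fix sets of integers $\mathit{num}$, strings $\mathit{str}$, table identifiers $\mathit{tid}$, localities $l$, data variables $x$ and locality variables $u$. Expressions: $e ::= \mathit{num}\mid\mathit{str}\mid\mathit{tid}\mid l\mid x\mid u\mid e_1\cdot e_2\mid e_1\,\mathit{aop}\,e_2\mid\{e_1,\dots,e_n\}$ ($n\ge 0$), where $\cdot$ is string concatenation, $\mathit{aop}$ ranges over binary arithmetic operators on integers (assumed total: no overflow, division by zero yields $0$), and $\{e_1,\dots,e_n\}$ is a multiset whose elements contain no multisets. Predicates: $\psi::=\mathsf{true}\mid e_1\,\mathit{cop}\,e_2\mid e_1\in e_2\mid\neg\psi\mid\psi_1\wedge\psi_2$, where $\mathit{cop}$ ranges over equality (on integers, strings, localities) and orderings (numerical on integers, alphabetical on strings). Tuples: $t::=e_1,\dots,e_n$ ($n>0$); a one-component tuple is identified with its component and a one-factor product with its factor. Types: $\tau_d::=\mathit{Int}\mid\mathit{String}\mid\mathit{Loc}\mid\mathit{Id}$; $\tau_m::=\{\tau_d\}\mid\tau_d$ (multisets with elements of type $\tau_d$, or data types); product types $\tau_m^1\times\dots\times\tau_m^n$; and $\mathit{Bool}$.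 Evaluation. Values are integers, strings, table identifiers, localities and multisets of these. $[\![\mathit{num}]\!]=\mathit{num}$, $[\![\mathit{str}]\!]=\mathit{str}$, $[\![\mathit{tid}]\!]=\mathit{tid}$, $[\![l]\!]=l$; variables $x,u$ do not evaluate to values (their evaluation is $\mathit{err}$); $[\![e_1\cdot e_2]\!]$ is the concatenation of $[\![e_1]\!]$ and $[\![e_2]\!]$ if both are strings, else $\mathit{err}$; $[\![e_1\,\mathit{aop}\,e_2]\!]=[\![e_1]\!]\,\mathit{aop}\,[\![e_2]\!]$ if both are integers, else $\mathit{err}$; $[\![\{e_1,\dots,e_n\}]\!]=\{[\![e_1]\!],\dots,[\![e_n]\!]\}$ if all $[\![e_j]\!]$ are values of one and the same type $\tau_d$, else $\mathit{err}$. Predicates evaluate into $\{\mathit{tt},\mathit{ff},\mathit{err}\}$: $[\![\mathsf{true}]\!]=\mathit{tt}$; $[\![e_1\,\mathit{cop}\,e_2]\!]$ is the result of the comparison if $[\![e_1]\!],[\![e_2]\!]$ are values of the same type $\tau_d$, else $\mathit{err}$; $[\![e_1\in e_2]\!]$ is the result of the membership test if $[\![e_2]\!]$ is a multiset of values of the type of $[\![e_1]\!]$, else $\mathit{err}$; $[\![\neg\psi]\!]$ is $\mathit{ff}$, $\mathit{tt}$, $\mathit{err}$ according as $[\![\psi]\!]$ is $\mathit{tt}$, $\mathit{ff}$, $\mathit{err}$; $[\![\psi_1\wedge\psi_2]\!]$ is $\mathit{tt}$ if both are $\mathit{tt}$, $\mathit{err}$ if either is $\mathit{err}$, and $\mathit{ff}$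 otherwise. Tuples: $[\![e_1,\dots,e_n]\!]=[\![e_1]\!],\dots,[\![e_n]\!]$ if no $[\![e_j]\!]$ is $\mathit{err}$, else $\mathit{err}$. Well-sortedness $\Vdash$ of values: $\mathit{num}\Vdash\mathit{Int}$, $\mathit{str}\Vdash\mathit{String}$, $\mathit{tid}\Vdash\mathit{Id}$, $l\Vdash\mathit{Loc}$; $\{v_1,\dots,v_n\}\Vdash\{\tau_d\}$ if $v_i\Vdash\tau_d$ for all $i$; $v_1,\dots,v_n\Vdash\tau_1\times\dots\times\tau_n$ if $v_i\Vdash\tau_i$ for all $i$. Nothing else (in particular not $\mathit{err}$) is well-sorted. Typing. A typing environment is a finite sequence of bindings of variables to types; $[]$ is the empty one. Rules: $\Gamma\vdash x\triangleright\tau$ if $\Gamma(x)=\tau\neq\mathit{Loc}$; $\Gamma\vdash u\triangleright\mathit{Loc}$ if $\Gamma(u)=\mathit{Loc}$; $\mathit{num}\triangleright\mathit{Int}$; $\mathit{str}\triangleright\mathit{String}$; $\mathit{tid}\triangleright\mathit{Id}$; $l\triangleright\mathit{Loc}$; $e_1\cdot e_2\triangleright\mathit{String}$ if both $e_i\triangleright\mathit{String}$; $e_1\,\mathit{aop}\,e_2\triangleright\mathit{Int}$ if both $e_i\triangleright\mathit{Int}$; $\{e_1,\dots,e_n\}\triangleright\{\tau_d\}$ if every $e_i\triangleright\tau_d$. Predicates: $\mathsf{true}\triangleright\mathit{Bool}$; $e_1\,\mathit{cop}\,e_2\triangleright\mathit{Bool}$ if $e_1\triangleright\tau_d$ and $e_2\triangleright\tau_d$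 for some $\tau_d$; $e_1\in e_2\triangleright\mathit{Bool}$ if $e_1\triangleright\tau_d$ and $e_2\triangleright\{\tau_d\}$; $\neg\psi$ and $\psi_1\wedge\psi_2$ have type $\mathit{Bool}$ if the subpredicates do. Tuples: $e_1,\dots,e_n\triangleright\tau_1\times\dots\times\tau_n$ if $e_i\triangleright\tau_i$ for all $i$ (all judgments under the same $\Gamma$). -}

module Defs where

open import Data.Bool using (Bool; true; false; if_then_else_; _∧_)
open import Data.Integer using (ℤ)
import Data.Integer as ℤ
open import Data.Nat using (ℕ)
import Data.Nat as ℕ
open import Data.String using (String) renaming (_++_ to _++ˢ_)
import Data.String as Str
open import Data.List using (List; []; _∷_)
open import Data.Bool.ListAction using (any; all)
open import Data.List.NonEmpty using (List⁺; _∷_; toList)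
open import Data.List.Relation.Unary.All using (All)
open import Data.List.Relation.Binary.Pointwise using (Pointwise)
open import Data.Product using (Σ; _,_; _×_; proj₁; proj₂)
open import Data.Maybe using (Maybe; just; nothing)
open import Relation.Nullary using (Dec; yes; no; ¬_)
open import Relation.Nullary.Decidable using (⌊_⌋)
open import Relation.Binary.PropositionalEquality using (_≡_; _≢_; refl)

TableId : Set
TableId = ℕ

Locality : Set
Locality = ℕ

DVar : Set
DVar = ℕ

LVar : Set
LVar = ℕ

data DType : Set where
  TInt TString TLoc TId : DType

data MType : Set where
  dat  : DType → MType
  mset : DType → MType

-- Types: products τ_m¹ × … × τ_mⁿ (n ≥ 1) and Bool.  A one-factor
-- product is identified with its factor.
data Ty : Set where
  prod  : List⁺ MType → Ty
  TBool : Ty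

⌜_⌝ : MType → Ty
⌜ m ⌝ = prod (m ∷ [])

DVal : DType → Set
DVal TInt    = ℤ
DVal TString = String
DVal TLoc    = Locality
DVal TId     = TableId

BVal : Set
BVal = Σ DType DVal

data Val : Set where
  base : BVal → Val
  ms   : List BVal → Val      -- multiset (order irrelevant)

data Res (A : Set) : Set where
  err : Res A
  ok  : A → Res A

data PRes : Set where
  tt ff err : PRes

AOp : Set
AOp = ℤ → ℤ → ℤ

Cop : Set
Cop = (d : DType) → DVal d → DVal d → Bool

data Expr : Set where
  num   : ℤ → Expr
  str   : String → Expr
  tid   : TableId → Expr
  loc   : Locality → Expr
  var   : DVar → Expr
  lvar  : LVar → Expr
  _·_   : Expr → Expr → Expr
  arith : AOp → Expr → Expr → Expr
  set   : List Expr → Expr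

data Pred : Set where
  ptrue : Pred
  cmp   : Cop → Expr → Expr → Pred
  mem   : Expr → Expr → Pred
  pnot  : Pred → Pred
  pand  : Pred → Pred → Pred

Tuple : Set
Tuple = List⁺ Expr

data SetFree : Expr → Set where
  num   : ∀ n → SetFree (num n)
  str   : ∀ s → SetFree (str s)
  tid   : ∀ i → SetFree (tid i)
  loc   : ∀ l → SetFree (loc l)
  var   : ∀ x → SetFree (var x)
  lvar  : ∀ u → SetFree (lvar u)
  cat   : ∀ {e₁ e₂} → SetFree e₁ → SetFree e₂ → SetFree (e₁ · e₂)
  arith : ∀ {f e₁ e₂} → SetFree e₁ → SetFree e₂ → SetFree (arith f e₁ e₂)

-- syntactic side condition of the grammar: the elements of a
-- multiset expression contain no multisets
data WF : Expr → Set where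
  num   : ∀ n → WF (num n)
  str   : ∀ s → WF (str s)
  tid   : ∀ i → WF (tid i)
  loc   : ∀ l → WF (loc l)
  var   : ∀ x → WF (var x)
  lvar  : ∀ u → WF (lvar u)
  cat   : ∀ {e₁ e₂} → WF e₁ → WF e₂ → WF (e₁ · e₂)
  arith : ∀ {f e₁ e₂} → WF e₁ → WF e₂ → WF (arith f e₁ e₂)
  set   : ∀ {es} → All SetFree es → WF (set es)

data WFᵖ : Pred → Set where
  ptrue : WFᵖ ptrue
  cmp   : ∀ {c e₁ e₂} → WF e₁ → WF e₂ → WFᵖ (cmp c e₁ e₂)
  mem   : ∀ {e₁ e₂} → WF e₁ → WF e₂ → WFᵖ (mem e₁ e₂)
  pnot  : ∀ {ψ} → WFᵖ ψ → WFᵖ (pnot ψ)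
  pand  : ∀ {ψ₁ ψ₂} → WFᵖ ψ₁ → WFᵖ ψ₂ → WFᵖ (pand ψ₁ ψ₂)

_≟ᵈ_ : (d d' : DType) → Dec (d ≡ d')
TInt    ≟ᵈ TInt    = yes refl
TString ≟ᵈ TString = yes refl
TLoc    ≟ᵈ TLoc    = yes refl
TId     ≟ᵈ TId     = yes refl
TInt    ≟ᵈ TString = no λ ()
TInt    ≟ᵈ TLoc    = no λ ()
TInt    ≟ᵈ TId     = no λ ()
TString ≟ᵈ TInt    = no λ ()
TString ≟ᵈ TLoc    = no λ ()
TString ≟ᵈ TId     = no λ ()
TLoc    ≟ᵈ TInt    = no λ ()
TLoc    ≟ᵈ TString = no λ ()
TLoc    ≟ᵈ TId     = no λ ()
TId     ≟ᵈ TInt    = no λ ()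
TId     ≟ᵈ TString = no λ ()
TId     ≟ᵈ TLoc    = no λ ()

eqDVal : (d : DType) → DVal d → DVal d → Bool
eqDVal TInt    x y = ⌊ x ℤ.≟ y ⌋
eqDVal TString x y = ⌊ x Str.≟ y ⌋
eqDVal TLoc    x y = ⌊ x ℕ.≟ y ⌋
eqDVal TId     x y = ⌊ x ℕ.≟ y ⌋

eqBVal : BVal → BVal → Bool
eqBVal (d , x) (d' , y) with d ≟ᵈ d'
... | yes refl = eqDVal d x y
... | no _     = false

hasType : DType → BVal → Bool
hasType d (d' , _) = ⌊ d' ≟ᵈ d ⌋

concatR : Res Val → Res Val → Res Val
concatR (ok (base (TString , s))) (ok (base (TString , s'))) = ok (base (TString , s ++ˢ s'))
concatR _ _ = err

arithR : AOp → Res Val → Res Val → Res Val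
arithR f (ok (base (TInt , m))) (ok (base (TInt , n))) = ok (base (TInt , f m n))
arithR f _ _ = err

toBases : List (Res Val) → Maybe (List BVal)
toBases [] = just []
toBases (ok (base v) ∷ rs) with toBases rs
... | just vs = just (v ∷ vs)
... | nothing = nothing
toBases (_ ∷ rs) = nothing

sameType : List BVal → Bool
sameType [] = true
sameType ((d , _) ∷ vs) = all (hasType d) vs

mkSet : List (Res Val) → Res Val
mkSet rs with toBases rs
... | nothing = err
... | just vs = if sameType vs then ok (ms vs) else err

mutual
  ⟦_⟧ : Expr → Res Val
  ⟦ num n ⟧ = ok (base (TInt , n))
  ⟦ str s ⟧ = ok (base (TString , s))
  ⟦ tid i ⟧ = ok (base (TId , i))
  ⟦ loc l ⟧ = ok (base (TLoc , l))
  ⟦ var x ⟧ = err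
  ⟦ lvar u ⟧ = err
  ⟦ e₁ · e₂ ⟧ = concatR ⟦ e₁ ⟧ ⟦ e₂ ⟧
  ⟦ arith f e₁ e₂ ⟧ = arithR f ⟦ e₁ ⟧ ⟦ e₂ ⟧
  ⟦ set es ⟧ = mkSet ⟦ es ⟧*

  ⟦_⟧* : List Expr → List (Res Val)
  ⟦ [] ⟧* = []
  ⟦ e ∷ es ⟧* = ⟦ e ⟧ ∷ ⟦ es ⟧*

evalList : List Expr → Res (List Val)
evalList [] = ok []
evalList (e ∷ es) with ⟦ e ⟧ | evalList es
... | ok v | ok vs = ok (v ∷ vs)
... | _    | _     = err

⟦_⟧ᵗ : Tuple → Res (List⁺ Val)
⟦ e ∷ es ⟧ᵗ with ⟦ e ⟧ | evalList es
... | ok v | ok vs = ok (v ∷ vs)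
... | _    | _     = err

fromBool : Bool → PRes
fromBool true  = tt
fromBool false = ff

cmpR : Cop → Res Val → Res Val → PRes
cmpR c (ok (base (d , x))) (ok (base (d' , y))) with d ≟ᵈ d'
... | yes refl = fromBool (c d x y)
... | no _     = err
cmpR c _ _ = err

memR : Res Val → Res Val → PRes
memR (ok (base (d , x))) (ok (ms vs)) =
  if all (hasType d) vs then fromBool (any (eqBVal (d , x)) vs) else err
memR _ _ = err

notR : PRes → PRes
notR tt  = ff
notR ff  = tt
notR err = err

andR : PRes → PRes → PRes
andR err _   = err
andR _   err = err
andR tt  tt  = tt
andR _   _   = ff

⟦_⟧ᵖ : Pred → PRes
⟦ ptrue ⟧ᵖ = tt
⟦ cmp c e₁ e₂ ⟧ᵖ = cmpR c ⟦ e₁ ⟧ ⟦ e₂ ⟧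
⟦ mem e₁ e₂ ⟧ᵖ = memR ⟦ e₁ ⟧ ⟦ e₂ ⟧
⟦ pnot ψ ⟧ᵖ = notR ⟦ ψ ⟧ᵖ
⟦ pand ψ₁ ψ₂ ⟧ᵖ = andR ⟦ ψ₁ ⟧ᵖ ⟦ ψ₂ ⟧ᵖ

data _⊩ᵐ_ : Val → MType → Set where
  ws-base : ∀ {d x} → base (d , x) ⊩ᵐ dat d
  ws-set  : ∀ {vs d} → All (λ v → proj₁ v ≡ d) vs → ms vs ⊩ᵐ mset d

data _⊩ᵗ_ : List⁺ Val → Ty → Set where
  ws-prod : ∀ {vs ms'} → Pointwise _⊩ᵐ_ (toList vs) (toList ms') → vs ⊩ᵗ prod ms'

_⊩_ : Val → Ty → Set
v ⊩ τ = (v ∷ []) ⊩ᵗ τ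

data _⊩ʳ_ : Res Val → Ty → Set where
  ok : ∀ {v τ} → v ⊩ τ → ok v ⊩ʳ τ

data _⊩ʳᵗ_ : Res (List⁺ Val) → Ty → Set where
  ok : ∀ {vs τ} → vs ⊩ᵗ τ → ok vs ⊩ʳᵗ τ

data Var : Set where
  dv : DVar → Var
  lv : LVar → Var

eqVar : Var → Var → Bool
eqVar (dv x) (dv y) = ⌊ x ℕ.≟ y ⌋
eqVar (lv x) (lv y) = ⌊ x ℕ.≟ y ⌋
eqVar _ _ = false

-- typing environments: finite sequences of bindings (most recent first)
Ctx : Set
Ctx = List (Var × Ty)

lookupᶜ : Ctx → Var → Maybe Ty
lookupᶜ [] _ = nothing
lookupᶜ ((y , τ) ∷ Γ) x = if eqVar x y then just τ else lookupᶜ Γ x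

data _⊢_▷_ (Γ : Ctx) : Expr → Ty → Set where
  t-var   : ∀ {x τ} → lookupᶜ Γ (dv x) ≡ just τ → τ ≢ ⌜ dat TLoc ⌝ → Γ ⊢ var x ▷ τ
  t-lvar  : ∀ {u} → lookupᶜ Γ (lv u) ≡ just ⌜ dat TLoc ⌝ → Γ ⊢ lvar u ▷ ⌜ dat TLoc ⌝
  t-num   : ∀ {n} → Γ ⊢ num n ▷ ⌜ dat TInt ⌝
  t-str   : ∀ {s} → Γ ⊢ str s ▷ ⌜ dat TString ⌝
  t-tid   : ∀ {i} → Γ ⊢ tid i ▷ ⌜ dat TId ⌝
  t-loc   : ∀ {l} → Γ ⊢ loc l ▷ ⌜ dat TLoc ⌝
  t-cat   : ∀ {e₁ e₂} → Γ ⊢ e₁ ▷ ⌜ dat TString ⌝ → Γ ⊢ e₂ ▷ ⌜ dat TString ⌝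
          → Γ ⊢ e₁ · e₂ ▷ ⌜ dat TString ⌝
  t-arith : ∀ {f e₁ e₂} → Γ ⊢ e₁ ▷ ⌜ dat TInt ⌝ → Γ ⊢ e₂ ▷ ⌜ dat TInt ⌝
          → Γ ⊢ arith f e₁ e₂ ▷ ⌜ dat TInt ⌝
  t-set   : ∀ {es d} → All (λ e → Γ ⊢ e ▷ ⌜ dat d ⌝) es → Γ ⊢ set es ▷ ⌜ mset d ⌝

data _⊢ᵗ_▷_ (Γ : Ctx) : Tuple → Ty → Set where
  t-tuple : ∀ {t ms'} → Pointwise (λ e m → Γ ⊢ e ▷ ⌜ m ⌝) (toList t) (toList ms')
          → Γ ⊢ᵗ t ▷ prod ms'

data _⊢ᵖ_▷_ (Γ : Ctx) : Pred → Ty → Set where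
  t-true : Γ ⊢ᵖ ptrue ▷ TBool
  t-cmp  : ∀ {c e₁ e₂ d} → Γ ⊢ e₁ ▷ ⌜ dat d ⌝ → Γ ⊢ e₂ ▷ ⌜ dat d ⌝ → Γ ⊢ᵖ cmp c e₁ e₂ ▷ TBool
  t-mem  : ∀ {e₁ e₂ d} → Γ ⊢ e₁ ▷ ⌜ dat d ⌝ → Γ ⊢ e₂ ▷ ⌜ mset d ⌝ → Γ ⊢ᵖ mem e₁ e₂ ▷ TBool
  t-not  : ∀ {ψ} → Γ ⊢ᵖ ψ ▷ TBool → Γ ⊢ᵖ pnot ψ ▷ TBool
  t-and  : ∀ {ψ₁ ψ₂} → Γ ⊢ᵖ ψ₁ ▷ TBool → Γ ⊢ᵖ ψ₂ ▷ TBool → Γ ⊢ᵖ pand ψ₁ ψ₂ ▷ TBool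

-- In the empty environment typing and evaluation reject exactly the same
-- expressions: variables (untypable, evaluating to err), operands of the
-- wrong kind, and multisets whose elements are not all base values of one
-- kind.  So every evaluation operator sends well-sorted arguments to a
-- well-sorted result, and conversely a well-sorted (for predicates: non-err)
-- result forces arguments of exactly the kinds the typing rules demand.
module Submission where

open import Defs
open import Data.Bool using (true; false)
open import Data.Bool.ListAction using (all)
open import Data.Bool.Properties using (T-≡)
open import Data.List using (List; []; _∷_)
open import Data.List.NonEmpty using (_∷_; toList)
open import Data.List.Relation.Unary.All as All using (All; []; _∷_)
open import Data.List.Relation.Unary.All.Properties using (all⁺; all⁻)
open import Data.List.Relation.Binary.Pointwise using (Pointwise; []; _∷_)
open import Data.Maybe using (just)
open import Data.Product using (∃-syntax; _×_; _,_; proj₁)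
open import Data.Sum using (_⊎_; inj₁; inj₂; [_,_]′)
open import Function using (_∘_)
open import Function.Bundles using (_⇔_; mk⇔; Equivalence)
open import Data.Empty using (⊥-elim)
open import Relation.Nullary using (¬_; yes; no; contradiction)
open import Relation.Nullary.Decidable using (toWitness; fromWitness)
open import Relation.Binary.PropositionalEquality
  using (_≡_; _≢_; refl; cong; ≡-≟-identity)

⊩-base : ∀ {d x} → ok (base (d , x)) ⊩ʳ ⌜ dat d ⌝
⊩-base = ok (ws-prod (ws-base ∷ []))

all-hasType : ∀ d vs → all (hasType d) vs ≡ true ⇔ All (λ v → proj₁ v ≡ d) vs
all-hasType d vs = mk⇔
  (All.map toWitness ∘ all⁺ (hasType d) vs ∘ Equivalence.from T-≡)
  (Equivalence.to T-≡ ∘ all⁻ (hasType d) ∘ All.map fromWitness)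

sameType-≡true : ∀ {d} vs → All (λ v → proj₁ v ≡ d) vs → sameType vs ≡ true
sameType-≡true []       []          = refl
sameType-≡true (_ ∷ vs) (refl ∷ ps) = Equivalence.from (all-hasType _ vs) ps

toBases-⊩ : ∀ {d rs} → All (_⊩ʳ ⌜ dat d ⌝) rs
          → ∃[ vs ] toBases rs ≡ just vs × All (λ v → proj₁ v ≡ d) vs
toBases-⊩ [] = [] , refl , []
toBases-⊩ {rs = _ ∷ rs} (ok (ws-prod (ws-base ∷ [])) ∷ ps) with toBases rs | toBases-⊩ ps
... | _ | vs , refl , qs = _ ∷ vs , refl , refl ∷ qs

toBases-⊩⁻ : ∀ {d} rs {vs} → toBases rs ≡ just vs → All (λ v → proj₁ v ≡ d) vs
           → All (_⊩ʳ ⌜ dat d ⌝) rs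
toBases-⊩⁻ [] _ _ = []
toBases-⊩⁻ (ok (base v) ∷ rs) eq qs with toBases rs in eq′
toBases-⊩⁻ (ok (base v) ∷ rs) refl (refl ∷ qs) | just _ = ⊩-base ∷ toBases-⊩⁻ rs eq′ qs

mkSet-⊩ : ∀ {d} rs → All (_⊩ʳ ⌜ dat d ⌝) rs → mkSet rs ⊩ʳ ⌜ mset d ⌝
mkSet-⊩ rs ps with toBases rs | toBases-⊩ ps
... | _ | vs , refl , qs rewrite sameType-≡true vs qs = ok (ws-prod (ws-set qs ∷ []))

mkSet-⊩⁻ : ∀ rs {τ} → mkSet rs ⊩ʳ τ → ∃[ d ] τ ≡ ⌜ mset d ⌝ × All (_⊩ʳ ⌜ dat d ⌝) rs
mkSet-⊩⁻ rs p with toBases rs in eq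
... | just vs with sameType vs
mkSet-⊩⁻ rs (ok (ws-prod (ws-set qs ∷ []))) | just vs | true = _ , refl , toBases-⊩⁻ rs eq qs

concatR-⊩ : ∀ {r₁ r₂} → r₁ ⊩ʳ ⌜ dat TString ⌝ → r₂ ⊩ʳ ⌜ dat TString ⌝
          → concatR r₁ r₂ ⊩ʳ ⌜ dat TString ⌝
concatR-⊩ (ok (ws-prod (ws-base ∷ []))) (ok (ws-prod (ws-base ∷ []))) = ⊩-base

concatR-⊩⁻ : ∀ r₁ r₂ {τ} → concatR r₁ r₂ ⊩ʳ τ
           → τ ≡ ⌜ dat TString ⌝ × r₁ ⊩ʳ ⌜ dat TString ⌝ × r₂ ⊩ʳ ⌜ dat TString ⌝
concatR-⊩⁻ (ok (base (TString , _))) (ok (base (TString , _))) (ok (ws-prod (ws-base ∷ []))) =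
  refl , ⊩-base , ⊩-base
concatR-⊩⁻ err                       _                         ()
concatR-⊩⁻ (ok (ms _))               _                         ()
concatR-⊩⁻ (ok (base (TInt , _)))    _                         ()
concatR-⊩⁻ (ok (base (TLoc , _)))    _                         ()
concatR-⊩⁻ (ok (base (TId , _)))     _                         ()
concatR-⊩⁻ (ok (base (TString , _))) err                       ()
concatR-⊩⁻ (ok (base (TString , _))) (ok (ms _))               ()
concatR-⊩⁻ (ok (base (TString , _))) (ok (base (TInt , _)))    ()
concatR-⊩⁻ (ok (base (TString , _))) (ok (base (TLoc , _)))    ()
concatR-⊩⁻ (ok (base (TString , _))) (ok (base (TId , _)))     ()

arithR-⊩ : ∀ {f r₁ r₂} → r₁ ⊩ʳ ⌜ dat TInt ⌝ → r₂ ⊩ʳ ⌜ dat TInt ⌝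
         → arithR f r₁ r₂ ⊩ʳ ⌜ dat TInt ⌝
arithR-⊩ (ok (ws-prod (ws-base ∷ []))) (ok (ws-prod (ws-base ∷ []))) = ⊩-base

arithR-⊩⁻ : ∀ f r₁ r₂ {τ} → arithR f r₁ r₂ ⊩ʳ τ
          → τ ≡ ⌜ dat TInt ⌝ × r₁ ⊩ʳ ⌜ dat TInt ⌝ × r₂ ⊩ʳ ⌜ dat TInt ⌝
arithR-⊩⁻ f (ok (base (TInt , _))) (ok (base (TInt , _))) (ok (ws-prod (ws-base ∷ []))) =
  refl , ⊩-base , ⊩-base
arithR-⊩⁻ f err                       _                         ()
arithR-⊩⁻ f (ok (ms _))               _                         ()
arithR-⊩⁻ f (ok (base (TString , _))) _                         ()
arithR-⊩⁻ f (ok (base (TLoc , _)))    _                         ()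
arithR-⊩⁻ f (ok (base (TId , _)))     _                         ()
arithR-⊩⁻ f (ok (base (TInt , _)))    err                       ()
arithR-⊩⁻ f (ok (base (TInt , _)))    (ok (ms _))               ()
arithR-⊩⁻ f (ok (base (TInt , _)))    (ok (base (TString , _))) ()
arithR-⊩⁻ f (ok (base (TInt , _)))    (ok (base (TLoc , _)))    ()
arithR-⊩⁻ f (ok (base (TInt , _)))    (ok (base (TId , _)))     ()

mutual
  ⊢⇒⊩ʳ : ∀ {e τ} → [] ⊢ e ▷ τ → ⟦ e ⟧ ⊩ʳ τ
  ⊢⇒⊩ʳ (t-var () _)
  ⊢⇒⊩ʳ (t-lvar ())
  ⊢⇒⊩ʳ t-num             = ⊩-base
  ⊢⇒⊩ʳ t-str             = ⊩-base
  ⊢⇒⊩ʳ t-tid             = ⊩-base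
  ⊢⇒⊩ʳ t-loc             = ⊩-base
  ⊢⇒⊩ʳ (t-cat p q)       = concatR-⊩ (⊢⇒⊩ʳ p) (⊢⇒⊩ʳ q)
  ⊢⇒⊩ʳ (t-arith p q)     = arithR-⊩ (⊢⇒⊩ʳ p) (⊢⇒⊩ʳ q)
  ⊢⇒⊩ʳ (t-set {es} ps)   = mkSet-⊩ ⟦ es ⟧* (All-⊢⇒⊩ʳ ps)

  All-⊢⇒⊩ʳ : ∀ {d es} → All (λ e → [] ⊢ e ▷ ⌜ dat d ⌝) es → All (_⊩ʳ ⌜ dat d ⌝) ⟦ es ⟧*
  All-⊢⇒⊩ʳ []       = []
  All-⊢⇒⊩ʳ (p ∷ ps) = ⊢⇒⊩ʳ p ∷ All-⊢⇒⊩ʳ ps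

mutual
  ⊩ʳ⇒⊢ : ∀ e {τ} → ⟦ e ⟧ ⊩ʳ τ → [] ⊢ e ▷ τ
  ⊩ʳ⇒⊢ (num _) (ok (ws-prod (ws-base ∷ []))) = t-num
  ⊩ʳ⇒⊢ (str _) (ok (ws-prod (ws-base ∷ []))) = t-str
  ⊩ʳ⇒⊢ (tid _) (ok (ws-prod (ws-base ∷ []))) = t-tid
  ⊩ʳ⇒⊢ (loc _) (ok (ws-prod (ws-base ∷ []))) = t-loc
  ⊩ʳ⇒⊢ (e₁ · e₂) p with concatR-⊩⁻ ⟦ e₁ ⟧ ⟦ e₂ ⟧ p
  ... | refl , p₁ , p₂ = t-cat (⊩ʳ⇒⊢ e₁ p₁) (⊩ʳ⇒⊢ e₂ p₂)
  ⊩ʳ⇒⊢ (arith f e₁ e₂) p with arithR-⊩⁻ f ⟦ e₁ ⟧ ⟦ e₂ ⟧ p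
  ... | refl , p₁ , p₂ = t-arith (⊩ʳ⇒⊢ e₁ p₁) (⊩ʳ⇒⊢ e₂ p₂)
  ⊩ʳ⇒⊢ (set es) p with mkSet-⊩⁻ ⟦ es ⟧* p
  ... | _ , refl , ps = t-set (All-⊩ʳ⇒⊢ es ps)

  All-⊩ʳ⇒⊢ : ∀ es {d} → All (_⊩ʳ ⌜ dat d ⌝) ⟦ es ⟧* → All (λ e → [] ⊢ e ▷ ⌜ dat d ⌝) es
  All-⊩ʳ⇒⊢ []       []       = []
  All-⊩ʳ⇒⊢ (e ∷ es) (p ∷ ps) = ⊩ʳ⇒⊢ e p ∷ All-⊩ʳ⇒⊢ es ps

⊢⇔⊩ʳ : ∀ e τ → ([] ⊢ e ▷ τ) ⇔ (⟦ e ⟧ ⊩ʳ τ)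
⊢⇔⊩ʳ e τ = mk⇔ ⊢⇒⊩ʳ (⊩ʳ⇒⊢ e)

data _⊩ʳˡ_ : Res (List Val) → List MType → Set where
  ok : ∀ {vs mts} → Pointwise _⊩ᵐ_ vs mts → ok vs ⊩ʳˡ mts

evalList-⊩ : ∀ es {mts} → Pointwise (λ r m → r ⊩ʳ ⌜ m ⌝) ⟦ es ⟧* mts → evalList es ⊩ʳˡ mts
evalList-⊩ []       []       = ok []
evalList-⊩ (e ∷ es) (p ∷ ps) with ⟦ e ⟧ | p | evalList es | evalList-⊩ es ps
... | _ | ok (ws-prod (w ∷ [])) | _ | ok ws = ok (w ∷ ws)

evalList-⊩⁻ : ∀ es {mts} → evalList es ⊩ʳˡ mts → Pointwise (λ r m → r ⊩ʳ ⌜ m ⌝) ⟦ es ⟧* mts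
evalList-⊩⁻ []       (ok []) = []
evalList-⊩⁻ (e ∷ es) p with ⟦ e ⟧ | evalList es | evalList-⊩⁻ es
evalList-⊩⁻ (e ∷ es) (ok (w ∷ ws)) | ok _ | ok _ | ih = ok (ws-prod (w ∷ [])) ∷ ih (ok ws)

⟦⟧ᵗ-⊩ : ∀ t {mts} → Pointwise (λ r m → r ⊩ʳ ⌜ m ⌝) ⟦ toList t ⟧* (toList mts)
      → ⟦ t ⟧ᵗ ⊩ʳᵗ prod mts
⟦⟧ᵗ-⊩ (e ∷ es) {_ ∷ _} (p ∷ ps) with ⟦ e ⟧ | p | evalList es | evalList-⊩ es ps
... | _ | ok (ws-prod (w ∷ [])) | _ | ok ws = ok (ws-prod (w ∷ ws))

⟦⟧ᵗ-⊩⁻ : ∀ t {mts} → ⟦ t ⟧ᵗ ⊩ʳᵗ prod mts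
       → Pointwise (λ r m → r ⊩ʳ ⌜ m ⌝) ⟦ toList t ⟧* (toList mts)
⟦⟧ᵗ-⊩⁻ (e ∷ es) p with ⟦ e ⟧ | evalList es | evalList-⊩⁻ es
⟦⟧ᵗ-⊩⁻ (e ∷ es) (ok (ws-prod (w ∷ ws))) | ok _ | ok _ | ih = ok (ws-prod (w ∷ [])) ∷ ih (ok ws)

¬⊩ʳᵗ-TBool : ∀ {r} → ¬ (r ⊩ʳᵗ TBool)
¬⊩ʳᵗ-TBool (ok ())

Pointwise-⊢⇒⊩ʳ : ∀ {es mts} → Pointwise (λ e m → [] ⊢ e ▷ ⌜ m ⌝) es mts
               → Pointwise (λ r m → r ⊩ʳ ⌜ m ⌝) ⟦ es ⟧* mts
Pointwise-⊢⇒⊩ʳ []       = []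
Pointwise-⊢⇒⊩ʳ (p ∷ ps) = ⊢⇒⊩ʳ p ∷ Pointwise-⊢⇒⊩ʳ ps

Pointwise-⊩ʳ⇒⊢ : ∀ es {mts} → Pointwise (λ r m → r ⊩ʳ ⌜ m ⌝) ⟦ es ⟧* mts
               → Pointwise (λ e m → [] ⊢ e ▷ ⌜ m ⌝) es mts
Pointwise-⊩ʳ⇒⊢ []       []       = []
Pointwise-⊩ʳ⇒⊢ (e ∷ es) (p ∷ ps) = ⊩ʳ⇒⊢ e p ∷ Pointwise-⊩ʳ⇒⊢ es ps

⊢ᵗ⇔⊩ʳᵗ : ∀ t τ → ([] ⊢ᵗ t ▷ τ) ⇔ (⟦ t ⟧ᵗ ⊩ʳᵗ τ)
⊢ᵗ⇔⊩ʳᵗ t (prod mts) = mk⇔ (λ { (t-tuple ps) → ⟦⟧ᵗ-⊩ t (Pointwise-⊢⇒⊩ʳ ps) })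
                           (t-tuple ∘ Pointwise-⊩ʳ⇒⊢ (toList t) ∘ ⟦⟧ᵗ-⊩⁻ t)
⊢ᵗ⇔⊩ʳᵗ t TBool      = mk⇔ (λ ()) (⊥-elim ∘ ¬⊩ʳᵗ-TBool)

fromBool≢err : ∀ b → fromBool b ≢ err
fromBool≢err true  ()
fromBool≢err false ()

cmpR-≢err : ∀ {c d r₁ r₂} → r₁ ⊩ʳ ⌜ dat d ⌝ → r₂ ⊩ʳ ⌜ dat d ⌝ → cmpR c r₁ r₂ ≢ err
cmpR-≢err {d = d} (ok (ws-prod (ws-base ∷ []))) (ok (ws-prod (ws-base ∷ [])))
  rewrite ≡-≟-identity _≟ᵈ_ {d} refl = fromBool≢err _

cmpR-≢err⁻ : ∀ c r₁ r₂ → cmpR c r₁ r₂ ≢ err → ∃[ d ] r₁ ⊩ʳ ⌜ dat d ⌝ × r₂ ⊩ʳ ⌜ dat d ⌝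
cmpR-≢err⁻ c err                 _                    ne = contradiction refl ne
cmpR-≢err⁻ c (ok (ms _))         _                    ne = contradiction refl ne
cmpR-≢err⁻ c (ok (base _))       err                  ne = contradiction refl ne
cmpR-≢err⁻ c (ok (base _))       (ok (ms _))          ne = contradiction refl ne
cmpR-≢err⁻ c (ok (base (d , _))) (ok (base (d′ , _))) ne with d ≟ᵈ d′
... | yes refl = d , ⊩-base , ⊩-base
... | no _     = contradiction refl ne

memR-≢err : ∀ {d r₁ r₂} → r₁ ⊩ʳ ⌜ dat d ⌝ → r₂ ⊩ʳ ⌜ mset d ⌝ → memR r₁ r₂ ≢ err
memR-≢err {d} (ok (ws-prod (ws-base ∷ []))) (ok (ws-prod (ws-set {vs} qs ∷ [])))
  rewrite Equivalence.from (all-hasType d vs) qs = fromBool≢err _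

memR-≢err⁻ : ∀ r₁ r₂ → memR r₁ r₂ ≢ err → ∃[ d ] r₁ ⊩ʳ ⌜ dat d ⌝ × r₂ ⊩ʳ ⌜ mset d ⌝
memR-≢err⁻ err                 _             ne = contradiction refl ne
memR-≢err⁻ (ok (ms _))         _             ne = contradiction refl ne
memR-≢err⁻ (ok (base _))       err           ne = contradiction refl ne
memR-≢err⁻ (ok (base _))       (ok (base _)) ne = contradiction refl ne
memR-≢err⁻ (ok (base (d , _))) (ok (ms vs))  ne with all (hasType d) vs in eq
... | true  = d , ⊩-base , ok (ws-prod (ws-set (Equivalence.to (all-hasType d vs) eq) ∷ []))
... | false = contradiction refl ne

notR-≡err⁻ : ∀ {r} → notR r ≡ err → r ≡ err
notR-≡err⁻ {err} refl = refl

andR-≡err⁻ : ∀ r₁ r₂ → andR r₁ r₂ ≡ err → r₁ ≡ err ⊎ r₂ ≡ err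
andR-≡err⁻ err _   _ = inj₁ refl
andR-≡err⁻ tt  err _ = inj₂ refl
andR-≡err⁻ ff  err _ = inj₂ refl

andR-errˡ : ∀ {r₁} r₂ → r₁ ≡ err → andR r₁ r₂ ≡ err
andR-errˡ _ refl = refl

andR-errʳ : ∀ r₁ {r₂} → r₂ ≡ err → andR r₁ r₂ ≡ err
andR-errʳ tt  refl = refl
andR-errʳ ff  refl = refl
andR-errʳ err refl = refl

⊢ᵖ⇒≢err : ∀ {ψ} → [] ⊢ᵖ ψ ▷ TBool → ⟦ ψ ⟧ᵖ ≢ err
⊢ᵖ⇒≢err t-true      ()
⊢ᵖ⇒≢err (t-cmp p q) = cmpR-≢err (⊢⇒⊩ʳ p) (⊢⇒⊩ʳ q)
⊢ᵖ⇒≢err (t-mem p q) = memR-≢err (⊢⇒⊩ʳ p) (⊢⇒⊩ʳ q)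
⊢ᵖ⇒≢err (t-not p)   = ⊢ᵖ⇒≢err p ∘ notR-≡err⁻
⊢ᵖ⇒≢err (t-and p q) = [ ⊢ᵖ⇒≢err p , ⊢ᵖ⇒≢err q ]′ ∘ andR-≡err⁻ _ _

≢err⇒⊢ᵖ : ∀ ψ → ⟦ ψ ⟧ᵖ ≢ err → [] ⊢ᵖ ψ ▷ TBool
≢err⇒⊢ᵖ ptrue _ = t-true
≢err⇒⊢ᵖ (cmp c e₁ e₂) ne with cmpR-≢err⁻ c ⟦ e₁ ⟧ ⟦ e₂ ⟧ ne
... | _ , p₁ , p₂ = t-cmp (⊩ʳ⇒⊢ e₁ p₁) (⊩ʳ⇒⊢ e₂ p₂)
≢err⇒⊢ᵖ (mem e₁ e₂) ne with memR-≢err⁻ ⟦ e₁ ⟧ ⟦ e₂ ⟧ ne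
... | _ , p₁ , p₂ = t-mem (⊩ʳ⇒⊢ e₁ p₁) (⊩ʳ⇒⊢ e₂ p₂)
≢err⇒⊢ᵖ (pnot ψ) ne = t-not (≢err⇒⊢ᵖ ψ (ne ∘ cong notR))
≢err⇒⊢ᵖ (pand ψ₁ ψ₂) ne =
  t-and (≢err⇒⊢ᵖ ψ₁ (ne ∘ andR-errˡ ⟦ ψ₂ ⟧ᵖ)) (≢err⇒⊢ᵖ ψ₂ (ne ∘ andR-errʳ ⟦ ψ₁ ⟧ᵖ))

⊢ᵖ⇔≢err : ∀ ψ → ([] ⊢ᵖ ψ ▷ TBool) ⇔ (⟦ ψ ⟧ᵖ ≢ err)
⊢ᵖ⇔≢err ψ = mk⇔ ⊢ᵖ⇒≢err (≢err⇒⊢ᵖ ψ)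

lemmaB6 : ((e : Expr) → WF e → (τ : Ty) → ([] ⊢ e ▷ τ) ⇔ (⟦ e ⟧ ⊩ʳ τ))
    × ((t : Tuple) → All WF (toList t) → (τ : Ty) → ([] ⊢ᵗ t ▷ τ) ⇔ (⟦ t ⟧ᵗ ⊩ʳᵗ τ))
    × ((ψ : Pred) → WFᵖ ψ → ([] ⊢ᵖ ψ ▷ TBool) ⇔ (⟦ ψ ⟧ᵖ ≢ err))
lemmaB6 = (λ e _ → ⊢⇔⊩ʳ e) , (λ t _ → ⊢ᵗ⇔⊩ʳᵗ t) , (λ ψ _ → ⊢ᵖ⇔≢err ψ)
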